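{- There is a fixed singly exponential function $g$ such that the following holds. Let $\Phi$ be a finite set of linear inequalities of the form $a_0+a_1x_1+\cdots+a_nx_n\le b_0+b_1x_1+\cdots+b_nx_n$ in variables $x_1,\dots,x_n$, with all coefficients $a_i,b_i\in\mathbb N$. If $\Phi$ has a solution over $\mathbb N^*$, then $\Phi$ has a solution over $\mathbb N^*$ in which every finite value is at most $g(\lVert\Phi\rVert)$.
   Context: $\mathbb N^*=\mathbb N\cup\{\aleph_0\}$, with order and arithmetic extended by: $\aleph_0>n$ for all $n\in\mathbb N$; $\aleph_0+\aleph_0=\aleph_0\cdot\aleph_0=\aleph_0$; $n+\aleph_0=\aleph_0+n=\aleph_0$ for all $n\in\mathbb N$; $0\cdot\aleph_0=\aleph_0\cdot0=0$; $n\cdot\aleph_0=\aleph_0\cdot n=\aleph_0$ for $n>0$. A solution over $\mathbb N^*$ is an assignment of elements of $\mathbb N^*$ to $x_1,\dots,x_n$ satisfying all inequalities with this arithmetic. $\lVert\Phi\rVert$ is the size of $\Phi$ measured in the usual way with integers coded in binary. -}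

module Defs where

open import Data.Nat using (ℕ; zero; suc; _+_; _*_; _^_; _≤_)
open import Data.Nat.Logarithm using (⌊log₂_⌋)
open import Data.Fin using (Fin)
open import Data.Vec using (Vec; _∷_; []; lookup)
open import Data.List using (List)
open import Data.List.Relation.Unary.All using (All)
open import Data.Product using (∃-syntax)
open import Relation.Binary.PropositionalEquality using (_≡_)

data ℕ* : Set where
  fin : ℕ → ℕ*
  ℵ₀  : ℕ*

infixl 6 _+*_
infixl 7 _·*_
infix 4 _≤*_

_+*_ : ℕ* → ℕ* → ℕ*
fin m +* fin n = fin (m + n)
fin m +* ℵ₀    = ℵ₀
ℵ₀    +* _     = ℵ₀

_·*_ : ℕ* → ℕ* → ℕ*
fin m       ·* fin n       = fin (m * n)
fin zero    ·* ℵ₀          = fin 0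
fin (suc m) ·* ℵ₀          = ℵ₀
ℵ₀          ·* fin zero    = fin 0
ℵ₀          ·* fin (suc n) = ℵ₀
ℵ₀          ·* ℵ₀          = ℵ₀

data _≤*_ : ℕ* → ℕ* → Set where
  fin≤fin : ∀ {m n} → m ≤ n → fin m ≤* fin n
  _≤ℵ₀    : ∀ x → x ≤* ℵ₀

-- A linear form c₀ + c₁x₁ + ⋯ + cₙxₙ with natural coefficients,
-- given by the coefficient vector (c₀, c₁, …, cₙ).
LinForm : ℕ → Set
LinForm n = Vec ℕ (suc n)

dot : ∀ {k} → Vec ℕ k → Vec ℕ* k → ℕ*
dot []       []       = fin 0
dot (c ∷ cs) (x ∷ xs) = fin c ·* x +* dot cs xs

evalForm : ∀ {n} → LinForm n → Vec ℕ* n → ℕ*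
evalForm (c₀ ∷ cs) x = fin c₀ +* dot cs x

record Ineq (n : ℕ) : Set where
  constructor _≤'_
  field
    lhs : LinForm n
    rhs : LinForm n
open Ineq public

Satisfies : ∀ {n} → Vec ℕ* n → Ineq n → Set
Satisfies x φ = evalForm (lhs φ) x ≤* evalForm (rhs φ) x

IsSolution : ∀ {n} → List (Ineq n) → Vec ℕ* n → Set
IsSolution Φ x = All (Satisfies x) Φ

-- Size: binary length of a natural number (at least 1 bit, also for 0)
bitsize : ℕ → ℕ
bitsize k = suc ⌊log₂ k ⌋

sizeVec : ∀ {k} → Vec ℕ k → ℕ
sizeVec []       = 0
sizeVec (c ∷ cs) = bitsize c + sizeVec cs

sizeIneq : ∀ {n} → Ineq n → ℕ
sizeIneq φ = sizeVec (lhs φ) + sizeVec (rhs φ)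

size : ∀ {n} → List (Ineq n) → ℕ
size List.[]       = 0
size (φ List.∷ Φ)  = sizeIneq φ + size Φ

FiniteValuesBoundedBy : ∀ {n} → ℕ → Vec ℕ* n → Set
FiniteValuesBoundedBy {n} B x = ∀ (i : Fin n) (k : ℕ) → lookup x i ≡ fin k → k ≤ B

SinglyExponential : (ℕ → ℕ) → Set
SinglyExponential g = ∃[ c ] (∀ m → g m ≤ 2 ^ ((suc m) ^ c))

module Submission where

-- Let S bound the coefficient sums of the right-hand sides and put
-- stretch S T = T + S(T+1).  If no finite value of a solution x lies in
-- (T, stretch S T], then replacing every value above T by ℵ₀ gives again a
-- solution: a right-hand side that stays finite only involves values ≤ T, so
-- it is at most S(T+1), and a left-hand side bounded by it cannot involve a
-- value above stretch S T either.  Along the orbit 0, stretch S 0, … each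
-- step from a threshold without such a gap lowers the number of finite values
-- above the threshold, so one of the first n+1 thresholds works; it is below
-- (S+1)ⁿ, and we may take S = 2^‖Φ‖ while n ≤ ‖Φ‖.

open import Defs
open import Data.Nat using (ℕ; zero; suc; _+_; _*_; _^_; _≤_; _<_; _≤?_; _<?_; z≤n; s≤s)
open import Data.Nat.Properties
open import Data.Nat.Logarithm using (⌊log₂_⌋; ⌊log₂⌋-mono-≤; ⌊log₂[2^n]⌋≡n)
open import Data.Vec using (Vec; []; _∷_; map; replicate; lookup; sum)
open import Data.Vec.Properties using (lookup-map; lookup-replicate)
open import Data.Vec.Relation.Unary.All as VecAll using ([]; _∷_)
open import Data.List using (List)
open import Data.List.Relation.Unary.All as ListAll using (All)
open import Data.Product using (Σ; ∃-syntax; _×_; _,_)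
open import Data.Sum as Sum using (_⊎_; inj₁; inj₂)
open import Data.Unit using (⊤; tt)
open import Function.Endo.Propositional ℕ using (^-homo) renaming (_^_ to _^ᶠ_)
open import Relation.Nullary using (yes; no; contradiction)
open import Relation.Binary.PropositionalEquality

private variable
  k n T U S : ℕ

data Cut (U B : ℕ) : ℕ* → ℕ* → Set where
  kept    : ∀ {v} → v ≤ B → Cut U B (fin v) (fin v)
  both-ℵ₀ : Cut U B ℵ₀ ℵ₀
  blown   : ∀ {v} → U < v → Cut U B (fin v) ℵ₀

Cut-mono : ∀ {B B' x y} → B ≤ B' → Cut U B x y → Cut U B' x y
Cut-mono B≤B' (kept v≤B) = kept (≤-trans v≤B B≤B')
Cut-mono B≤B' both-ℵ₀     = both-ℵ₀
Cut-mono B≤B' (blown U<v) = blown U<v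

Cut-·* : ∀ c {B x y} → Cut U B x y → Cut U (c * B) (fin c ·* x) (fin c ·* y)
Cut-·* zero    (kept _)          = kept z≤n
Cut-·* zero    both-ℵ₀           = kept z≤n
Cut-·* zero    (blown _)         = kept z≤n
Cut-·* (suc c) (kept v≤B)        = kept (*-monoʳ-≤ (suc c) v≤B)
Cut-·* (suc c) both-ℵ₀           = both-ℵ₀
Cut-·* (suc c) (blown {v} U<v)   = blown (<-≤-trans U<v (m≤n*m v (suc c)))

Cut-+* : ∀ {B B' x y x' y'} → Cut U B x y → Cut U B' x' y' →
         Cut U (B + B') (x +* x') (y +* y')
Cut-+* (kept v≤B)        (kept w≤B')      = kept (+-mono-≤ v≤B w≤B')
Cut-+* (kept _)          both-ℵ₀          = both-ℵ₀
Cut-+* (kept {v} _)      (blown {w} U<w)  = blown (<-≤-trans U<w (m≤n+m w v))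
Cut-+* both-ℵ₀           _                = both-ℵ₀
Cut-+* (blown {v} U<v)   (kept {w} _)     = blown (<-≤-trans U<v (m≤m+n v w))
Cut-+* (blown _)         both-ℵ₀          = both-ℵ₀
Cut-+* (blown {v} U<v)   (blown {w} _)    = blown (<-≤-trans U<v (m≤m+n v w))

Cut-≤* : ∀ {Bl Br lx ly rx ry} → Cut U Bl lx ly → Cut U Br rx ry → Br ≤ U →
         lx ≤* rx → ly ≤* ry
Cut-≤* _           both-ℵ₀     _    _              = _ ≤ℵ₀
Cut-≤* _           (blown _)   _    _              = _ ≤ℵ₀
Cut-≤* (kept _)    (kept _)    _    l≤r            = l≤r
Cut-≤* both-ℵ₀     (kept _)    _    ()
Cut-≤* (blown U<l) (kept r≤Br) Br≤U (fin≤fin l≤r) =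
  contradiction (≤-trans l≤r (≤-trans r≤Br Br≤U)) (<⇒≱ U<l)

cut : ℕ → ℕ* → ℕ*
cut T (fin v) with v ≤? T
... | yes _ = fin v
... | no _  = ℵ₀
cut T ℵ₀ = ℵ₀

cut-fin-≤ : ∀ z {v} → cut T z ≡ fin v → v ≤ T
cut-fin-≤ {T} (fin v) e with v ≤? T
cut-fin-≤ (fin v) refl | yes v≤T = v≤T
cut-fin-≤ (fin v) ()   | no _
cut-fin-≤ ℵ₀ ()

map-cut-bounded : ∀ T (x : Vec ℕ* n) → FiniteValuesBoundedBy T (map (cut T) x)
map-cut-bounded T x i k e = cut-fin-≤ (lookup x i) (trans (sym (lookup-map i (cut T) x)) e)

GapAt : ℕ → ℕ → ℕ* → Set
GapAt T U (fin v) = v ≤ T ⊎ U < v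
GapAt T U ℵ₀      = ⊤

Gap : ℕ → ℕ → Vec ℕ* n → Set
Gap T U = VecAll.All (GapAt T U)

cut-Cut : ∀ z → GapAt T U z → Cut U T z (cut T z)
cut-Cut {T} (fin v) gap with v ≤? T | gap
... | yes v≤T | _        = kept v≤T
... | no v≰T  | inj₁ v≤T = contradiction v≤T v≰T
... | no _    | inj₂ U<v = blown U<v
cut-Cut ℵ₀ _ = both-ℵ₀

Cut-dot : (cs : Vec ℕ k) (xs : Vec ℕ* k) → Gap T U xs →
          Cut U (sum cs * T) (dot cs xs) (dot cs (map (cut T) xs))
Cut-dot []       []       []         = kept z≤n
Cut-dot {T = T} (c ∷ cs) (x ∷ xs) (gap ∷ gaps) =
  Cut-mono (≤-reflexive (sym (*-distribʳ-+ T c (sum cs))))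
    (Cut-+* (Cut-·* c (cut-Cut x gap)) (Cut-dot cs xs gaps))

Cut-evalForm : (f : LinForm n) (xs : Vec ℕ* n) → Gap T U xs →
               Cut U (sum f * suc T) (evalForm f xs) (evalForm f (map (cut T) xs))
Cut-evalForm {T = T} (c₀ ∷ cs) xs gaps =
  Cut-mono bound (Cut-+* (kept {v = c₀} ≤-refl) (Cut-dot cs xs gaps))
  where
  open ≤-Reasoning
  bound : c₀ + sum cs * T ≤ (c₀ + sum cs) * suc T
  bound = begin
    c₀ + sum cs * T             ≤⟨ +-mono-≤ (m≤m*n c₀ (suc T)) (*-monoʳ-≤ (sum cs) (n≤1+n T)) ⟩
    c₀ * suc T + sum cs * suc T ≡⟨ *-distribʳ-+ (suc T) c₀ (sum cs) ⟨
    (c₀ + sum cs) * suc T       ∎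

stretch : ℕ → ℕ → ℕ
stretch S T = T + S * suc T

cut-preserves-Satisfies : (xs : Vec ℕ* n) → Gap T (stretch S T) xs → (φ : Ineq n) →
                          sum (rhs φ) ≤ S → Satisfies xs φ → Satisfies (map (cut T) xs) φ
cut-preserves-Satisfies {T = T} {S} xs gaps φ rhs≤S =
  Cut-≤* (Cut-evalForm (lhs φ) xs gaps) (Cut-evalForm (rhs φ) xs gaps) rhs-bound
  where
  rhs-bound : sum (rhs φ) * suc T ≤ stretch S T
  rhs-bound = ≤-trans (*-monoˡ-≤ (suc T) rhs≤S) (m≤n+m (S * suc T) T)

cut-preserves-IsSolution : (xs : Vec ℕ* n) → Gap T (stretch S T) xs →
                           (Φ : List (Ineq n)) → All (λ φ → sum (rhs φ) ≤ S) Φ →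
                           IsSolution Φ xs → IsSolution Φ (map (cut T) xs)
cut-preserves-IsSolution xs gaps Φ rhs≤S sol =
  ListAll.zipWith (λ {φ} (bound , sat) → cut-preserves-Satisfies xs gaps φ bound sat)
    (rhs≤S , sol)

countAbove : ℕ → Vec ℕ* n → ℕ
countAbove T []           = 0
countAbove T (ℵ₀ ∷ xs)    = countAbove T xs
countAbove T (fin v ∷ xs) with T <? v
... | yes _ = suc (countAbove T xs)
... | no _  = countAbove T xs

countAbove≤length : ∀ T (xs : Vec ℕ* n) → countAbove T xs ≤ n
countAbove≤length T []           = z≤n
countAbove≤length T (ℵ₀ ∷ xs)    = m≤n⇒m≤1+n (countAbove≤length T xs)
countAbove≤length T (fin v ∷ xs) with T <? v
... | yes _ = s≤s (countAbove≤length T xs)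
... | no _  = m≤n⇒m≤1+n (countAbove≤length T xs)

countAbove-antitone : T ≤ U → (xs : Vec ℕ* n) → countAbove U xs ≤ countAbove T xs
countAbove-antitone T≤U []           = z≤n
countAbove-antitone T≤U (ℵ₀ ∷ xs)    = countAbove-antitone T≤U xs
countAbove-antitone {T} {U} T≤U (fin v ∷ xs) with T <? v | U <? v
... | yes _   | yes _   = s≤s (countAbove-antitone T≤U xs)
... | yes _   | no _    = m≤n⇒m≤1+n (countAbove-antitone T≤U xs)
... | no T≮v  | yes U<v = contradiction (≤-<-trans T≤U U<v) T≮v
... | no _    | no _    = countAbove-antitone T≤U xs

gap-or-countAbove-< : T ≤ U → (xs : Vec ℕ* n) →
                      Gap T U xs ⊎ countAbove U xs < countAbove T xs
gap-or-countAbove-< T≤U []           = inj₁ []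
gap-or-countAbove-< T≤U (ℵ₀ ∷ xs)    = Sum.map₁ (tt ∷_) (gap-or-countAbove-< T≤U xs)
gap-or-countAbove-< {T} {U} T≤U (fin v ∷ xs)
  with T <? v | U <? v | gap-or-countAbove-< T≤U xs
... | no T≮v | yes U<v | _         = contradiction (≤-<-trans T≤U U<v) T≮v
... | no T≮v | no _    | inj₁ gaps = inj₁ (inj₁ (≮⇒≥ T≮v) ∷ gaps)
... | no _   | no _    | inj₂ drop = inj₂ drop
... | yes _  | yes U<v | inj₁ gaps = inj₁ (inj₂ U<v ∷ gaps)
... | yes _  | yes _   | inj₂ drop = inj₂ (s≤s drop)
... | yes _  | no _    | _         = inj₂ (s≤s (countAbove-antitone T≤U xs))

gap-in-orbit : (f : ℕ → ℕ) → (∀ T → T ≤ f T) → (xs : Vec ℕ* n) →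
               ∀ k T → countAbove T xs ≤ k →
               ∃[ j ] (j ≤ k × Gap ((f ^ᶠ j) T) (f ((f ^ᶠ j) T)) xs)
gap-in-orbit f inflationary xs k T count≤k with gap-or-countAbove-< (inflationary T) xs
... | inj₁ gaps = 0 , z≤n , gaps
gap-in-orbit f inflationary xs zero T count≤0 | inj₂ drop =
  contradiction (≤-trans drop count≤0) n≮0
gap-in-orbit f inflationary xs (suc k) T count≤1+k | inj₂ drop
  with gap-in-orbit f inflationary xs k (f T) (≤-pred (≤-trans drop count≤1+k))
... | j , j≤k , gaps = suc j , s≤s j≤k , subst (λ T' → Gap T' (f T') xs) shift gaps
  where
  shift : (f ^ᶠ j) (f T) ≡ (f ^ᶠ suc j) T
  shift = trans (sym (cong-app (^-homo f j 1) T)) (cong (λ i → (f ^ᶠ i) T) (+-comm j 1))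

stretch-orbit : ∀ S j → suc ((stretch S ^ᶠ j) 0) ≡ suc S ^ j
stretch-orbit S zero    = refl
stretch-orbit S (suc j) = cong (suc S *_) (stretch-orbit S j)

cut-solution : ∀ S (Φ : List (Ineq n)) (x : Vec ℕ* n) →
               All (λ φ → sum (rhs φ) ≤ S) Φ → IsSolution Φ x →
               ∃[ T ] (T < suc S ^ n × IsSolution Φ (map (cut T) x))
cut-solution {n} S Φ x rhs≤S sol
  with gap-in-orbit (stretch S) (λ T → m≤m+n T (S * suc T)) x n 0 (countAbove≤length 0 x)
... | j , j≤n , gaps =
  (stretch S ^ᶠ j) 0
    , ≤-trans (≤-reflexive (stretch-orbit S j)) (^-monoʳ-≤ (suc S) j≤n)
    , cut-preserves-IsSolution x gaps Φ rhs≤S sol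

m<n⇒o<p⇒m+o<n*p : ∀ {m n o p} → m < n → o < p → m + o < n * p
m<n⇒o<p⇒m+o<n*p {m} {n} {o} {p} m<n o<p = begin-strict
  m + o           ≡⟨ +-comm m o ⟩
  o + m           ≤⟨ +-monoʳ-≤ o (m≤m*n m (suc o)) ⟩
  o + m * suc o   <⟨ n<1+n _ ⟩
  suc m * suc o   ≤⟨ *-mono-≤ m<n o<p ⟩
  n * p           ∎
  where open ≤-Reasoning

n<2^bitsize : ∀ c → c < 2 ^ bitsize c
n<2^bitsize c = ≰⇒> λ 2^bitsize≤c →
  1+n≰n (subst (_≤ ⌊log₂ c ⌋) (⌊log₂[2^n]⌋≡n (bitsize c)) (⌊log₂⌋-mono-≤ 2^bitsize≤c))

sum<2^sizeVec : (cs : Vec ℕ k) → sum cs < 2 ^ sizeVec cs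
sum<2^sizeVec []       = s≤s z≤n
sum<2^sizeVec (c ∷ cs) =
  <-≤-trans (m<n⇒o<p⇒m+o<n*p (n<2^bitsize c) (sum<2^sizeVec cs))
    (≤-reflexive (sym (^-distribˡ-+-* 2 (bitsize c) (sizeVec cs))))

length≤sizeVec : (cs : Vec ℕ k) → k ≤ sizeVec cs
length≤sizeVec []       = z≤n
length≤sizeVec (c ∷ cs) = s≤s (≤-trans (length≤sizeVec cs) (m≤n+m (sizeVec cs) ⌊log₂ c ⌋))

rhs-sum<2^size : (Φ : List (Ineq n)) → All (λ φ → sum (rhs φ) < 2 ^ size Φ) Φ
rhs-sum<2^size List.[]       = ListAll.[]
rhs-sum<2^size (φ List.∷ Φ) =
  <-≤-trans (sum<2^sizeVec (rhs φ))
    (^-monoʳ-≤ 2 (≤-trans (m≤n+m _ (sizeVec (lhs φ))) (m≤m+n (sizeIneq φ) (size Φ))))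
  ListAll.∷ ListAll.map (λ sum<2^size → <-≤-trans sum<2^size (^-monoʳ-≤ 2 (m≤n+m _ (sizeIneq φ))))
              (rhs-sum<2^size Φ)

1+2^m≤2^[1+m] : ∀ m → suc (2 ^ m) ≤ 2 ^ suc m
1+2^m≤2^[1+m] m = begin
  1 + 2 ^ m         ≤⟨ +-monoˡ-≤ (2 ^ m) (m^n>0 2 m) ⟩
  2 ^ m + 2 ^ m     ≡⟨ cong (2 ^ m +_) (+-identityʳ (2 ^ m)) ⟨
  2 ^ suc m         ∎
  where open ≤-Reasoning

solutionBound : ℕ → ℕ
solutionBound m = 2 ^ (suc m ^ 2)

≤solutionBound : ∀ m → n ≤ m → T < suc (2 ^ m) ^ n → T ≤ solutionBound m
≤solutionBound {n} {T} m n≤m T<[1+2^m]^n = <⇒≤ (begin-strict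
  T                     <⟨ T<[1+2^m]^n ⟩
  suc (2 ^ m) ^ n       ≤⟨ ^-monoˡ-≤ n (1+2^m≤2^[1+m] m) ⟩
  (2 ^ suc m) ^ n       ≡⟨ ^-*-assoc 2 (suc m) n ⟩
  2 ^ (suc m * n)       ≤⟨ ^-monoʳ-≤ 2 (*-monoʳ-≤ (suc m) n≤[1+m]*1) ⟩
  2 ^ (suc m ^ 2)       ∎)
  where
  open ≤-Reasoning
  n≤[1+m]*1 : n ≤ suc m * 1
  n≤[1+m]*1 = ≤-trans (m≤n⇒m≤1+n n≤m) (≤-reflexive (sym (*-identityʳ (suc m))))

small-solution : (Φ : List (Ineq n)) → ∃[ x ] IsSolution Φ x →
                 ∃[ y ] (IsSolution Φ y × FiniteValuesBoundedBy (solutionBound (size Φ)) y)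
-- n ≤ ‖Φ‖ fails for Φ = [], which the all-ℵ₀ vector solves.
small-solution {n} List.[] _ =
  replicate n ℵ₀ , ListAll.[] ,
  λ i k e → contradiction (trans (sym (lookup-replicate i ℵ₀)) e) λ ()
small-solution {n} Φ@(φ List.∷ _) (x , sol)
  with cut-solution (2 ^ size Φ) Φ x (ListAll.map <⇒≤ (rhs-sum<2^size Φ)) sol
... | T , T<[1+2^‖Φ‖]^n , cut-sol =
  map (cut T) x , cut-sol
    , λ i k e → ≤-trans (map-cut-bounded T x i k e)
                  (≤solutionBound (size Φ) n≤size T<[1+2^‖Φ‖]^n)
  where
  n≤size : n ≤ size Φ
  n≤size = ≤-trans (n≤1+n n) (≤-trans (length≤sizeVec (lhs φ))
             (≤-trans (m≤m+n _ (sizeVec (rhs φ))) (m≤m+n (sizeIneq φ) _)))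

lemma51 : Σ (ℕ → ℕ) λ g → SinglyExponential g × (∀ (n : ℕ) (Φ : List (Ineq n)) → (∃[ x ] IsSolution Φ x) → ∃[ y ] (IsSolution Φ y × FiniteValuesBoundedBy (g (size Φ)) y))
lemma51 = solutionBound , (2 , λ _ → ≤-refl) , λ _ → small-solution
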